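{- Consider the following interpretation. Each type is a set; for lists of types $t=A_1\cdots A_n$ and $t'=B_1\cdots B_m$, the diagrams $S:t\to t'$ are the constructive functions $A_1\cdots A_n\stackrel{c}{\longrightarrow}B_1\cdots B_m$. The constants are interpreted as: $\mathsf{Id}(t)$ is the identity function; $\mathsf{Split}(t)(x)=(x,x)$; $\mathsf{Sink}(t)(x)$ is the empty tuple; $\mathsf{Switch}(t,t')(x,x')=(x',x)$. Serial composition is $S;T=T\circ S$; parallel composition is $(S\,\|\,T)(x,y)=(S(x),T(y))$; and for $f:A\cdot B\stackrel{c}{\longrightarrow}A\cdot B'$ with $A$ a single type, $\mathsf{feedback}(f):B\stackrel{c}{\longrightarrow}B'$ is $\mathsf{feedback}(f)(y)=f_2(\mu x.\,f_1(x,y),\,y)$, where $f_1,f_2$ are the $A$- and $B'$-components of $f$ and $\mu x.\,f_1(x,y)$ is the least fixpoint of $x\mapsto f_1(x,y)$. Then this interpretation satisfies all of the following axioms (for all well-typed diagrams, all lists of types $t,t',t'',t_1,\dots,s,s',s''$, and all single types $a,b$; $\|$ binds more tightly than $;$, and $\mathsf{feedback}^2$ denotes applying $\mathsf{feedback}$ twice): (1) if $S:t\to t'$ then $\mathsf{Id}(t);S=S;\mathsf{Id}(t')=S$; (2) if $S:t_1\to t_2$, $T:t_2\to t_3$, $R:t_3\to t_4$ then $S;(T;R)=(S;T);R$; (3) $\mathsf{Id}(\epsilon)\,\|\,S=S\,\|\,\mathsf{Id}(\epsilon)=S$; (4) $S\,\|\,(T\,\|\,R)=(S\,\|\,T)\,\|\,R$;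 (5) if $S:s\to s'$, $S':s'\to s''$, $T:t\to t'$, $T':t'\to t''$ then $(S\,\|\,T);(S'\,\|\,T')=(S;S')\,\|\,(T;T')$; (6) $\mathsf{Split}(t);\mathsf{Sink}(t)\,\|\,\mathsf{Id}(t)=\mathsf{Id}(t)$; (7) $\mathsf{Split}(t);\mathsf{Switch}(t,t)=\mathsf{Split}(t)$; (8) $\mathsf{Split}(t);\mathsf{Id}(t)\,\|\,\mathsf{Split}(t)=\mathsf{Split}(t);\mathsf{Split}(t)\,\|\,\mathsf{Id}(t)$; (9) $\mathsf{Switch}(t,t'\cdot t'')=\mathsf{Switch}(t,t')\,\|\,\mathsf{Id}(t'');\mathsf{Id}(t')\,\|\,\mathsf{Switch}(t,t'')$; (10) $\mathsf{Sink}(t\cdot t')=\mathsf{Sink}(t)\,\|\,\mathsf{Sink}(t')$; (11) $\mathsf{Split}(t\cdot t')=\mathsf{Split}(t)\,\|\,\mathsf{Split}(t');\mathsf{Id}(t)\,\|\,\mathsf{Switch}(t,t')\,\|\,\mathsf{Id}(t')$; (12) if $S:s\to s'$, $T:t\to t'$ then $\mathsf{Switch}(s,t);T\,\|\,S;\mathsf{Switch}(t',s')=S\,\|\,T$; (13) $\mathsf{feedback}(\mathsf{Switch}(a,a))=\mathsf{Id}(a)$; (14) if $S:a\cdot s\to a\cdot t$ then $\mathsf{feedback}(S\,\|\,T)=\mathsf{feedback}(S)\,\|\,T$; (15) if $S:a\cdot s\to a\cdot t$, $A:s'\to s$, $B:t\to t'$ then $\mathsf{feedback}(\mathsf{Id}(a)\,\|\,A;S;\mathsf{Id}(a)\,\|\,B)=A;\mathsf{feedback}(S);B$;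 (16) if $S:a\cdot b\cdot s\to a\cdot b\cdot t$ then $\mathsf{feedback}^2(\mathsf{Switch}(b,a)\,\|\,\mathsf{Id}(s);S;\mathsf{Switch}(a,b)\,\|\,\mathsf{Id}(t))=\mathsf{feedback}^2(S)$.
   Context: Lists of types are written with $\cdot$ for concatenation and $\epsilon$ for the empty list. For a set $A$, $A^\bot=A\cup\{\bot\}$ with $\bot$ a fresh element, ordered by $a\le b\iff(a=\bot\lor a=b)$; this order is extended componentwise to products $A_1^\bot\times\cdots\times A_n^\bot$. A constructive function $f:A_1\cdots A_n\stackrel{c}{\longrightarrow}B_1\cdots B_m$ is a monotone function $f:A_1^\bot\times\cdots\times A_n^\bot\to B_1^\bot\times\cdots\times B_m^\bot$. Such monotone self-maps on these pointed cpos have least fixpoints. -}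

module Defs where

open import Data.List using (List; []; _∷_; _++_; [_])
open import Data.List.Properties using (++-assoc; ++-identityʳ)
open import Data.Maybe using (Maybe; nothing; just)
open import Data.Product using (Σ; _×_; _,_; proj₁; proj₂)
open import Data.Unit using (⊤; tt)
open import Relation.Binary.PropositionalEquality
  using (_≡_; refl; sym; trans; cong; subst₂)

Ty : Set₁
Ty = List Set

-- The flat domain A^⊥ (⊥ = nothing) and its order a ≤ b ⇔ a = ⊥ ∨ a = b

data _≤⊥_ {A : Set} : Maybe A → Maybe A → Set where
  ⊥≤   : ∀ {b} → nothing ≤⊥ b
  refl≤ : ∀ {a} → a ≤⊥ a

⟦_⟧ : Ty → Set
⟦ [] ⟧    = ⊤
⟦ A ∷ t ⟧ = Maybe A × ⟦ t ⟧

_⊑_ : {t : Ty} → ⟦ t ⟧ → ⟦ t ⟧ → Set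
_⊑_ {[]}    _        _        = ⊤
_⊑_ {A ∷ t} (a , x) (b , y) = (a ≤⊥ b) × (x ⊑ y)

⊑-refl : {t : Ty} (x : ⟦ t ⟧) → x ⊑ x
⊑-refl {[]}    _       = tt
⊑-refl {A ∷ t} (a , x) = refl≤ , ⊑-refl x

-- Constructive functions  t ⇒ t'  (monotone maps between the products)

record _⇒_ (t t' : Ty) : Set where
  constructor mk
  field
    fun  : ⟦ t ⟧ → ⟦ t' ⟧
    mono : ∀ {x y} → x ⊑ y → fun x ⊑ fun y
open _⇒_ public

-- Equality of diagrams with the same (domain, codomain): equality of the
-- underlying functions (pointwise, as function extensionality is not
-- available).
_≐_ : {t t' : Ty} → t ⇒ t' → t ⇒ t' → Set
S ≐ T = ∀ x → fun S x ≡ fun T x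
infix 4 _≐_ _≋_

cast : {s s' t t' : Ty} → s ≡ s' → t ≡ t' → s ⇒ t → s' ⇒ t'
cast p q S = subst₂ _⇒_ p q S

-- Equality of diagrams whose types are equal lists that are not
-- definitionally equal (e.g. (s·t)·r and s·(t·r)).
_≋_ : {s t s' t' : Ty} → s ⇒ t → s' ⇒ t' → Set₁
_≋_ {s} {t} {s'} {t'} S T =
  Σ (s ≡ s') λ p → Σ (t ≡ t') λ q → cast p q S ≐ T

split : (s : Ty) {t : Ty} → ⟦ s ++ t ⟧ → ⟦ s ⟧ × ⟦ t ⟧
split []      x       = tt , x
split (A ∷ s) (a , x) with split s x
... | (u , v) = (a , u) , v

join : {s t : Ty} → ⟦ s ⟧ → ⟦ t ⟧ → ⟦ s ++ t ⟧
join {[]}    _       y = y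
join {A ∷ s} (a , x) y = a , join x y

split-mono : (s : Ty) {t : Ty} {x y : ⟦ s ++ t ⟧} → x ⊑ y →
  (proj₁ (split s x) ⊑ proj₁ (split s y)) × (proj₂ (split s {t} x) ⊑ proj₂ (split s y))
split-mono []      p = tt , p
split-mono (A ∷ s) {t} {a , x} {b , y} (p , q) with split s {t} x | split s {t} y | split-mono s {t} {x} {y} q
... | (u , v) | (u' , v') | (r₁ , r₂) = (p , r₁) , r₂

join-mono : {s t : Ty} {x x' : ⟦ s ⟧} {y y' : ⟦ t ⟧} → x ⊑ x' → y ⊑ y' →
  join x y ⊑ join x' y'
join-mono {[]}    _        q = q
join-mono {A ∷ s} (p , p') q = p , join-mono {s} p' q

Id : (t : Ty) → t ⇒ t
Id t = mk (λ x → x) (λ p → p)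

Split : (t : Ty) → t ⇒ (t ++ t)
Split t = mk (λ x → join x x) (λ p → join-mono {t} p p)

Sink : (t : Ty) → t ⇒ []
Sink t = mk (λ _ → tt) (λ _ → tt)

Switch : (t t' : Ty) → (t ++ t') ⇒ (t' ++ t)
Switch t t' =
  mk (λ z → join (proj₂ (split t z)) (proj₁ (split t z)))
     (λ p → join-mono {t'} (proj₂ (split-mono t p)) (proj₁ (split-mono t p)))

_⨾_ : {t₁ t₂ t₃ : Ty} → t₁ ⇒ t₂ → t₂ ⇒ t₃ → t₁ ⇒ t₃
S ⨾ T = mk (λ x → fun T (fun S x)) (λ p → mono T (mono S p))

_∥_ : {s s' t t' : Ty} → s ⇒ s' → t ⇒ t' → (s ++ t) ⇒ (s' ++ t')
_∥_ {s} {s'} S T =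
  mk (λ z → join (fun S (proj₁ (split s z))) (fun T (proj₂ (split s z))))
     (λ p → join-mono {s'} (mono S (proj₁ (split-mono s p)))
                          (mono T (proj₂ (split-mono s p))))

infixl 5 _⨾_
infixr 6 _∥_

-- Kleene iteration: the chain ⊥ ≤ g ⊥ ≤ g (g ⊥) ≤ ⋯ of a monotone g on
-- the flat domain A^⊥ is stationary from g ⊥ on, so its supremum (the
-- least fixpoint) is g ⊥.  See μ-fix and μ-least below.
μ : {A : Set} → (Maybe A → Maybe A) → Maybe A
μ g = g nothing

private
  just≤ : {A : Set} {a : A} {v : Maybe A} → just a ≤⊥ v → v ≡ just a
  just≤ refl≤ = refl

μ-fix : {A : Set} (g : Maybe A → Maybe A) →
  (∀ {x y} → x ≤⊥ y → g x ≤⊥ g y) → g (μ g) ≡ μ g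
μ-fix g m with g nothing in eq | m {nothing} {g nothing} ⊥≤
... | nothing | _ = eq
... | just a  | r = just≤ r

μ-least : {A : Set} (g : Maybe A → Maybe A) →
  (∀ {x y} → x ≤⊥ y → g x ≤⊥ g y) → ∀ x → g x ≡ x → μ g ≤⊥ x
μ-least g m x e with m {nothing} {x} ⊥≤
... | r rewrite e = r

private
  ≤⊥-trans : {A : Set} {x y z : Maybe A} → x ≤⊥ y → y ≤⊥ z → x ≤⊥ z
  ≤⊥-trans ⊥≤    _ = ⊥≤
  ≤⊥-trans refl≤ q = q

  fix-mono : {A : Set} {s t : Ty} (f : (A ∷ s) ⇒ (A ∷ t)) {y y' : ⟦ s ⟧} →
    y ⊑ y' → μ (λ x → proj₁ (fun f (x , y))) ≤⊥ μ (λ x → proj₁ (fun f (x , y')))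
  fix-mono f p = proj₁ (mono f (⊥≤ , p))

feedback : {A : Set} {s t : Ty} → (A ∷ s) ⇒ (A ∷ t) → s ⇒ t
feedback f =
  mk (λ y → proj₂ (fun f (μ (λ x → proj₁ (fun f (x , y))) , y)))
     (λ p → proj₂ (mono f (fix-mono f p , p)))

-- Everything except feedback is a statement about tuples: once an input is
-- decomposed as a join of its components, split and join cancel and each
-- axiom reduces to an equation between joins, up to transport along the
-- list equalities (++-assoc, ++-identityʳ) that the statement casts along.
-- For feedback, the least fixpoint on a flat domain A^⊥ is reached after a
-- single Kleene step, μ g = g ⊥, so axioms (13)-(15) hold by computation
-- (split on a singleton prefix reduces as well).
-- Axiom (16) is Bekič's lemma: a monotone map g with g ⊥ = just a is
-- constant, so whichever of the two fixpoint components is defined first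
-- determines the other, and both nestings of μ produce the same pair.
module Submission where

open import Defs
open import Data.List using ([]; _∷_; _++_; [_])
open import Data.List.Properties using (++-assoc; ++-identityʳ)
open import Data.Maybe using (Maybe; just; nothing)
open import Data.Product using (_×_; _,_; proj₁; proj₂)
open import Data.Unit using (tt)
open import Function using (_∘_)
open import Relation.Binary.Core using (_Preserves₂_⟶_⟶_)
open import Relation.Binary.PropositionalEquality
  using (_≡_; refl; sym; trans; cong; cong₂; subst; module ≡-Reasoning)
open import Relation.Binary.PropositionalEquality.Properties
  using (subst-subst; subst-sym-subst)

private
  variable
    s s' t t' u u' r r' : Ty

split-join : (s : Ty) (x : ⟦ s ⟧) (y : ⟦ t ⟧) → split s (join x y) ≡ (x , y)
split-join []      x       y = refl
split-join (A ∷ s) (a , x) y rewrite split-join s x y = refl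

join-split : (s : Ty) (z : ⟦ s ++ t ⟧) →
  join (proj₁ (split s z)) (proj₂ (split s {t} z)) ≡ z
join-split []      z       = refl
join-split (A ∷ s) (a , z) = cong (a ,_) (join-split s z)

ext-join : {X : Set} (s : Ty) {f g : ⟦ s ++ t ⟧ → X} →
  (∀ (x : ⟦ s ⟧) (y : ⟦ t ⟧) → f (join x y) ≡ g (join x y)) → ∀ z → f z ≡ g z
ext-join s {f = f} {g} h z =
  subst (λ w → f w ≡ g w) (join-split s z) (h (proj₁ (split s z)) (proj₂ (split s z)))

ext-join₃ : {X : Set} (s t : Ty) {f g : ⟦ s ++ (t ++ r) ⟧ → X} →
  (∀ (x : ⟦ s ⟧) (y : ⟦ t ⟧) (z : ⟦ r ⟧) → f (join x (join y z)) ≡ g (join x (join y z))) →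
  ∀ w → f w ≡ g w
ext-join₃ s t h = ext-join s λ x → ext-join t (h x)

∥-join : (S : s ⇒ s') (T : t ⇒ t') (x : ⟦ s ⟧) (y : ⟦ t ⟧) →
  fun (S ∥ T) (join x y) ≡ join (fun S x) (fun T y)
∥-join {s} {s'} S T x y =
  cong (λ w → join {s'} (fun S (proj₁ w)) (fun T (proj₂ w))) (split-join s x y)

Switch-join : (s t : Ty) (x : ⟦ s ⟧) (y : ⟦ t ⟧) →
  fun (Switch s t) (join x y) ≡ join y x
Switch-join s t x y =
  cong (λ w → join {t} (proj₂ w) (proj₁ w)) (split-join s x y)

transport : s ≡ s' → ⟦ s ⟧ → ⟦ s' ⟧
transport = subst ⟦_⟧

transport-++ˡ : (s : Ty) (p : t ≡ t') (x : ⟦ s ⟧) (y : ⟦ t ⟧) →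
  transport (cong (s ++_) p) (join x y) ≡ join x (transport p y)
transport-++ˡ s refl x y = refl

transport-++-assoc : (s t r : Ty) (x : ⟦ s ⟧) (y : ⟦ t ⟧) (z : ⟦ r ⟧) →
  transport (++-assoc s t r) (join (join x y) z) ≡ join x (join y z)
transport-++-assoc []      t r x       y z = refl
transport-++-assoc (A ∷ s) t r (a , x) y z =
  trans (transport-++ˡ [ A ] (++-assoc s t r) (a , tt) _)
        (cong (a ,_) (transport-++-assoc s t r x y z))

transport-++-assoc⁻¹ : (s t r : Ty) (x : ⟦ s ⟧) (y : ⟦ t ⟧) (z : ⟦ r ⟧) →
  transport (sym (++-assoc s t r)) (join x (join y z)) ≡ join (join x y) z
transport-++-assoc⁻¹ s t r x y z = begin
  transport (sym (++-assoc s t r)) (join x (join y z))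
    ≡⟨ cong (transport (sym (++-assoc s t r))) (transport-++-assoc s t r x y z) ⟨
  transport (sym (++-assoc s t r)) (transport (++-assoc s t r) (join (join x y) z))
    ≡⟨ subst-sym-subst (++-assoc s t r) ⟩
  join (join x y) z ∎
  where open ≡-Reasoning

transport-++-identityʳ : (s : Ty) (x : ⟦ s ⟧) →
  transport (++-identityʳ s) (join x tt) ≡ x
transport-++-identityʳ []      x       = refl
transport-++-identityʳ (A ∷ s) (a , x) =
  trans (transport-++ˡ [ A ] (++-identityʳ s) (a , tt) _)
        (cong (a ,_) (transport-++-identityʳ s x))

transport-reassoc : (s t u r : Ty) (x : ⟦ s ⟧) (y : ⟦ t ⟧) (z : ⟦ u ⟧) (w : ⟦ r ⟧) →
  transport (trans (++-assoc s t (u ++ r)) (cong (s ++_) (sym (++-assoc t u r))))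
            (join (join x y) (join z w))
  ≡ join x (join (join y z) w)
transport-reassoc s t u r x y z w = begin
  transport (trans assoc₁ (cong (s ++_) (sym assoc₂))) (join (join x y) (join z w))
    ≡⟨ subst-subst assoc₁ ⟨
  transport (cong (s ++_) (sym assoc₂)) (transport assoc₁ (join (join x y) (join z w)))
    ≡⟨ cong (transport (cong (s ++_) (sym assoc₂))) (transport-++-assoc s t (u ++ r) x y _) ⟩
  transport (cong (s ++_) (sym assoc₂)) (join x (join y (join z w)))
    ≡⟨ transport-++ˡ s (sym assoc₂) x _ ⟩
  join x (transport (sym assoc₂) (join y (join z w)))
    ≡⟨ cong (join x) (transport-++-assoc⁻¹ t u r y z w) ⟩
  join x (join (join y z) w) ∎
  where
  open ≡-Reasoning
  assoc₁ = ++-assoc s t (u ++ r)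
  assoc₂ = ++-assoc t u r

fun-cast : (p : s ≡ s') (q : t ≡ t') (S : s ⇒ t) (x : ⟦ s ⟧) →
  fun (cast p q S) (transport p x) ≡ transport q (fun S x)
fun-cast refl refl S x = refl

cast-≐ : (p : s ≡ s') (q : t ≡ t') {S : s ⇒ t} {T : s' ⇒ t'} →
  (∀ x → transport q (fun S x) ≡ fun T (transport p x)) → cast p q S ≐ T
cast-≐ refl refl h = h

∥-identityʳ : (S : s ⇒ s') → S ∥ Id [] ≋ S
∥-identityʳ {s} {s'} S = ++-identityʳ s , ++-identityʳ s' ,
  cast-≐ (++-identityʳ s) (++-identityʳ s') {S ∥ Id []} {S} (ext-join s λ x _ → begin
    transport (++-identityʳ s') (fun (S ∥ Id []) (join x tt))
      ≡⟨ cong (transport (++-identityʳ s')) (∥-join S (Id []) x tt) ⟩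
    transport (++-identityʳ s') (join (fun S x) tt)
      ≡⟨ transport-++-identityʳ s' (fun S x) ⟩
    fun S x
      ≡⟨ cong (fun S) (transport-++-identityʳ s x) ⟨
    fun S (transport (++-identityʳ s) (join x tt)) ∎)
  where open ≡-Reasoning

∥-assoc : (S : s ⇒ s') (T : t ⇒ t') (R : r ⇒ r') → S ∥ (T ∥ R) ≋ (S ∥ T) ∥ R
∥-assoc {s} {s'} {t} {t'} {r} {r'} S T R = sym (++-assoc s t r) , sym (++-assoc s' t' r') ,
  cast-≐ (sym (++-assoc s t r)) (sym (++-assoc s' t' r')) {S ∥ (T ∥ R)} {(S ∥ T) ∥ R}
    (ext-join₃ s t λ x y z → begin
    transport (sym (++-assoc s' t' r')) (fun (S ∥ (T ∥ R)) (join x (join y z)))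
      ≡⟨ cong (transport (sym (++-assoc s' t' r')))
              (trans (∥-join S (T ∥ R) x _) (cong (join (fun S x)) (∥-join T R y z))) ⟩
    transport (sym (++-assoc s' t' r')) (join (fun S x) (join (fun T y) (fun R z)))
      ≡⟨ transport-++-assoc⁻¹ s' t' r' (fun S x) (fun T y) (fun R z) ⟩
    join (join (fun S x) (fun T y)) (fun R z)
      ≡⟨ trans (∥-join (S ∥ T) R (join x y) z) (cong (λ v → join v (fun R z)) (∥-join S T x y)) ⟨
    fun ((S ∥ T) ∥ R) (join (join x y) z)
      ≡⟨ cong (fun ((S ∥ T) ∥ R)) (transport-++-assoc⁻¹ s t r x y z) ⟨
    fun ((S ∥ T) ∥ R) (transport (sym (++-assoc s t r)) (join x (join y z))) ∎)
  where open ≡-Reasoning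

∥-⨾-interchange : (S : s ⇒ s') (S' : s' ⇒ u) (T : t ⇒ t') (T' : t' ⇒ u') →
  (S ∥ T) ⨾ (S' ∥ T') ≐ (S ⨾ S') ∥ (T ⨾ T')
∥-⨾-interchange {s} S S' T T' = ext-join s λ x y → begin
  fun (S' ∥ T') (fun (S ∥ T) (join x y))      ≡⟨ cong (fun (S' ∥ T')) (∥-join S T x y) ⟩
  fun (S' ∥ T') (join (fun S x) (fun T y))    ≡⟨ ∥-join S' T' _ _ ⟩
  join (fun S' (fun S x)) (fun T' (fun T y))  ≡⟨ ∥-join (S ⨾ S') (T ⨾ T') x y ⟨
  fun ((S ⨾ S') ∥ (T ⨾ T')) (join x y)        ∎
  where open ≡-Reasoning

Split-counit : (t : Ty) → Split t ⨾ Sink t ∥ Id t ≐ Id t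
Split-counit t x = cong proj₂ (split-join t x x)

Split-comm : (t : Ty) → Split t ⨾ Switch t t ≐ Split t
Split-comm t x = Switch-join t t x x

Split-coassoc : (t : Ty) → Split t ⨾ Id t ∥ Split t ≋ Split t ⨾ Split t ∥ Id t
Split-coassoc t = refl , sym (++-assoc t t t) ,
  cast-≐ refl (sym (++-assoc t t t)) {Split t ⨾ Id t ∥ Split t} {Split t ⨾ Split t ∥ Id t}
    λ x → begin
    transport (sym (++-assoc t t t)) (fun (Id t ∥ Split t) (join x x))
      ≡⟨ cong (transport (sym (++-assoc t t t))) (∥-join (Id t) (Split t) x x) ⟩
    transport (sym (++-assoc t t t)) (join x (join x x))
      ≡⟨ transport-++-assoc⁻¹ t t t x x x ⟩
    join (join x x) x
      ≡⟨ ∥-join (Split t) (Id t) x x ⟨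
    fun (Split t ∥ Id t) (join x x) ∎
  where open ≡-Reasoning

Split-++ : (t t' : Ty) → Split (t ++ t')
  ≋ cast refl (trans (++-assoc t t (t' ++ t')) (cong (t ++_) (sym (++-assoc t t' t'))))
         (Split t ∥ Split t')
    ⨾ Id t ∥ Switch t t' ∥ Id t'
Split-++ t t' = refl , q ,
  cast-≐ refl q {Split (t ++ t')} {cast refl P (Split t ∥ Split t') ⨾ middle}
    (ext-join t λ (x : ⟦ t ⟧) (y : ⟦ t' ⟧) → begin
    transport q (join {t ++ t'} (join x y) (join x y))
      ≡⟨ transport-reassoc t t' t t' x y x y ⟩
    join {t} x (join {t' ++ t} (join y x) y)
      ≡⟨ cong (λ v → join {t} x (join {t' ++ t} v y)) (Switch-join t t' x y) ⟨
    join {t} x (join {t' ++ t} (fun (Switch t t') (join x y)) y)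
      ≡⟨ cong (join {t} x) (∥-join (Switch t t') (Id t') (join x y) y) ⟨
    join {t} x (fun (Switch t t' ∥ Id t') (join {t ++ t'} (join x y) y))
      ≡⟨ ∥-join (Id t) (Switch t t' ∥ Id t') x _ ⟨
    fun middle (join {t} x (join {t ++ t'} (join x y) y))
      ≡⟨ cong (fun middle) (transport-reassoc t t t' t' x x y y) ⟨
    fun middle (transport P (join {t ++ t} (join x x) (join y y)))
      ≡⟨ cong (fun middle ∘ transport P) (∥-join (Split t) (Split t') x y) ⟨
    fun middle (transport P (fun (Split t ∥ Split t') (join x y)))
      ≡⟨ cong (fun middle) (fun-cast refl P (Split t ∥ Split t') (join x y)) ⟨
    fun middle (fun (cast refl P (Split t ∥ Split t')) (join x y)) ∎)
  where
  open ≡-Reasoning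
  q = trans (++-assoc t t' (t ++ t')) (cong (t ++_) (sym (++-assoc t' t t')))
  P = trans (++-assoc t t (t' ++ t')) (cong (t ++_) (sym (++-assoc t t' t')))
  middle = Id t ∥ Switch t t' ∥ Id t'

Switch-++ : (t t' t'' : Ty) → Switch t (t' ++ t'')
  ≋ cast refl (++-assoc t' t t'') (Switch t t' ∥ Id t'') ⨾ Id t' ∥ Switch t t''
Switch-++ t t' t'' = sym assocˡ , assocʳ ,
  cast-≐ (sym assocˡ) assocʳ {Switch t (t' ++ t'')} {R} (ext-join₃ t t' λ x y z → begin
    transport assocʳ (fun (Switch t (t' ++ t'')) (join {t} x (join {t'} y z)))
      ≡⟨ cong (transport assocʳ) (Switch-join t (t' ++ t'') x (join y z)) ⟩
    transport assocʳ (join {t' ++ t''} (join y z) x)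
      ≡⟨ transport-++-assoc t' t'' t y z x ⟩
    join {t'} y (join {t''} z x)
      ≡⟨ trans (∥-join (Id t') (Switch t t'') y (join x z))
               (cong (join {t'} y) (Switch-join t t'' x z)) ⟨
    fun (Id t' ∥ Switch t t'') (join {t'} y (join {t} x z))
      ≡⟨ cong (fun (Id t' ∥ Switch t t'')) (transport-++-assoc t' t t'' y x z) ⟨
    fun (Id t' ∥ Switch t t'') (transport assoc (join {t' ++ t} (join y x) z))
      ≡⟨ cong (fun (Id t' ∥ Switch t t'') ∘ transport assoc)
              (trans (∥-join (Switch t t') (Id t'') (join x y) z)
                     (cong (λ v → join {t' ++ t} v z) (Switch-join t t' x y))) ⟨
    fun (Id t' ∥ Switch t t'') (transport assoc (fun (Switch t t' ∥ Id t'') (join (join x y) z)))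
      ≡⟨ cong (fun (Id t' ∥ Switch t t'')) (fun-cast refl assoc (Switch t t' ∥ Id t'') _) ⟨
    fun R (join (join x y) z)
      ≡⟨ cong (fun R) (transport-++-assoc⁻¹ t t' t'' x y z) ⟨
    fun R (transport (sym assocˡ) (join x (join y z))) ∎)
  where
  open ≡-Reasoning
  assoc  = ++-assoc t' t t''
  assocˡ = ++-assoc t t' t''
  assocʳ = ++-assoc t' t'' t
  R = cast refl assoc (Switch t t' ∥ Id t'') ⨾ Id t' ∥ Switch t t''

Switch-natural : (S : s ⇒ s') (T : t ⇒ t') → Switch s t ⨾ T ∥ S ⨾ Switch t' s' ≐ S ∥ T
Switch-natural {s} {s'} {t} {t'} S T = ext-join s λ x y → begin
  fun (Switch t' s') (fun (T ∥ S) (fun (Switch s t) (join x y)))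
    ≡⟨ cong (fun (Switch t' s') ∘ fun (T ∥ S)) (Switch-join s t x y) ⟩
  fun (Switch t' s') (fun (T ∥ S) (join y x))
    ≡⟨ cong (fun (Switch t' s')) (∥-join T S y x) ⟩
  fun (Switch t' s') (join (fun T y) (fun S x))
    ≡⟨ Switch-join t' s' (fun T y) (fun S x) ⟩
  join (fun S x) (fun T y)
    ≡⟨ ∥-join S T x y ⟨
  fun (S ∥ T) (join x y) ∎
  where open ≡-Reasoning

≤⊥-just : {A : Set} {a : A} {u v : Maybe A} → u ≤⊥ v → u ≡ just a → v ≡ just a
≤⊥-just refl≤ e = e

μ-bekič : {A B : Set} (f : Maybe A → Maybe B → Maybe A) (g : Maybe A → Maybe B → Maybe B) →
  f Preserves₂ _≤⊥_ ⟶ _≤⊥_ ⟶ _≤⊥_ → g Preserves₂ _≤⊥_ ⟶ _≤⊥_ ⟶ _≤⊥_ →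
  let w* = μ λ w → g (μ λ x → f x w) w
      x* = μ λ x → f x (μ λ w → g x w)
  in (μ (λ x → f x w*) , w*) ≡ (x* , μ (λ w → g x* w))
μ-bekič f g f-mono g-mono with f nothing nothing in f⊥ | g nothing nothing in g⊥
... | just a  | _ =
  cong₂ _,_ (trans (f⊥-const _) (sym (f⊥-const _)))
            (cong (λ x → g x nothing) (sym (f⊥-const _)))
  where
  f⊥-const : ∀ w → f nothing w ≡ just a
  f⊥-const w = ≤⊥-just (f-mono ⊥≤ ⊥≤) f⊥
... | nothing | just b =
  cong₂ _,_ (cong (f nothing) g⊥) (trans g⊥ (sym (g⊥-const _)))
  where
  g⊥-const : ∀ x → g x nothing ≡ just b
  g⊥-const x = ≤⊥-just (g-mono ⊥≤ ⊥≤) g⊥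
... | nothing | nothing =
  cong₂ _,_ (cong (f nothing) g⊥) (trans g⊥ (sym (trans (cong (λ x → g x nothing) f⊥) g⊥)))

feedback²-Switch : {a b : Set} (S : (a ∷ b ∷ s) ⇒ (a ∷ b ∷ t)) →
  feedback (feedback (Switch [ b ] [ a ] ∥ Id s ⨾ S ⨾ Switch [ a ] [ b ] ∥ Id t))
  ≐ feedback (feedback S)
feedback²-Switch S y =
  cong (λ (x , w) → proj₂ (proj₂ (fun S (x , w , y))))
       (sym (μ-bekič (λ x w → proj₁ (fun S (x , w , y)))
                     (λ x w → proj₁ (proj₂ (fun S (x , w , y))))
                     (λ p q → proj₁ (mono S (p , q , ⊑-refl y)))
                     (λ p q → proj₁ (proj₂ (mono S (p , q , ⊑-refl y))))))

theorem1 :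
      (∀ {t t'} (S : t ⇒ t') → (Id t ⨾ S ≐ S) × (S ⨾ Id t' ≐ S))
    × (∀ {t₁ t₂ t₃ t₄} (S : t₁ ⇒ t₂) (T : t₂ ⇒ t₃) (R : t₃ ⇒ t₄) →
         S ⨾ (T ⨾ R) ≐ (S ⨾ T) ⨾ R)
    × (∀ {s s'} (S : s ⇒ s') → (Id [] ∥ S ≐ S) × (S ∥ Id [] ≋ S))
    × (∀ {s s' t t' r r'} (S : s ⇒ s') (T : t ⇒ t') (R : r ⇒ r') →
         S ∥ (T ∥ R) ≋ (S ∥ T) ∥ R)
    × (∀ {s s' s'' t t' t''} (S : s ⇒ s') (S' : s' ⇒ s'') (T : t ⇒ t') (T' : t' ⇒ t'') →
         (S ∥ T) ⨾ (S' ∥ T') ≐ (S ⨾ S') ∥ (T ⨾ T'))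
    × (∀ t → Split t ⨾ Sink t ∥ Id t ≐ Id t)
    × (∀ t → Split t ⨾ Switch t t ≐ Split t)
    × (∀ t → Split t ⨾ Id t ∥ Split t ≋ Split t ⨾ Split t ∥ Id t)
    × (∀ t t' t'' → Switch t (t' ++ t'')
         ≋ cast refl (++-assoc t' t t'') (Switch t t' ∥ Id t'') ⨾ Id t' ∥ Switch t t'')
    × (∀ t t' → Sink (t ++ t') ≐ Sink t ∥ Sink t')
    × (∀ t t' → Split (t ++ t')
         ≋ cast refl (trans (++-assoc t t (t' ++ t')) (cong (t ++_) (sym (++-assoc t t' t'))))
              (Split t ∥ Split t')
           ⨾ Id t ∥ Switch t t' ∥ Id t')
    × (∀ {s s' t t'} (S : s ⇒ s') (T : t ⇒ t') →
         Switch s t ⨾ T ∥ S ⨾ Switch t' s' ≐ S ∥ T)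
    × (∀ (a : Set) → feedback (Switch [ a ] [ a ]) ≐ Id [ a ])
    × (∀ {a : Set} {s t s' t'} (S : (a ∷ s) ⇒ (a ∷ t)) (T : s' ⇒ t') →
         feedback (S ∥ T) ≐ feedback S ∥ T)
    × (∀ {a : Set} {s t s' t'} (S : (a ∷ s) ⇒ (a ∷ t)) (A : s' ⇒ s) (B : t ⇒ t') →
         feedback (Id [ a ] ∥ A ⨾ S ⨾ Id [ a ] ∥ B) ≐ A ⨾ feedback S ⨾ B)
    × (∀ {a b : Set} {s t} (S : (a ∷ b ∷ s) ⇒ (a ∷ b ∷ t)) →
         feedback (feedback (Switch [ b ] [ a ] ∥ Id s ⨾ S ⨾ Switch [ a ] [ b ] ∥ Id t))
         ≐ feedback (feedback S))
theorem1 =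
    (λ S → (λ _ → refl) , (λ _ → refl))
  , (λ S T R _ → refl)
  , (λ S → (λ _ → refl) , ∥-identityʳ S)
  , ∥-assoc
  , ∥-⨾-interchange
  , Split-counit
  , Split-comm
  , Split-coassoc
  , Switch-++
  , (λ t t' _ → refl)
  , Split-++
  , Switch-natural
  , (λ a _ → refl)
  , (λ S T _ → refl)
  , (λ S A B _ → refl)
  , feedback²-Switch
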